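{- Let $\mathcal{G}_{\le 3}$ be the set of graphs with at most $3$ vertices. Writing (up to isomorphism) $K_1$ for one vertex, $\overline{K_2}$ for two isolated vertices, $K_2$ for an edge, $P_3$ for the path on three vertices, $K_3$ for the triangle, $\overline{K_3}$ for three isolated vertices, and $K_2\sqcup K_1$ for an edge plus an isolated vertex, we have: $\mathcal{C}_{\mathcal{S}}\cap\mathcal{G}_{\le3}=\mathcal{C}_{\overline{\mathcal{S}}}\cap\mathcal{G}_{\le3}=\{K_1,\overline{K_2}\}$; $\mathcal{C}_{\mathcal{S}\overline{\mathcal{S}}}\cap\mathcal{G}_{\le3}=\{K_1,\overline{K_2},K_2\}$; $\mathcal{C}_{\mathcal{P}}\cap\mathcal{G}_{\le3}=\{K_1,K_2,P_3\}$; $\mathcal{C}_{\mathcal{P}\mathcal{S}}\cap\mathcal{G}_{\le3}=\mathcal{C}_{\mathcal{P}\overline{\mathcal{S}}}\cap\mathcal{G}_{\le3}=\{K_1,\overline{K_2},K_2,P_3,K_3,\overline{K_3}\}$; $\mathcal{C}_{\mathcal{P}\mathcal{S}\overline{\mathcal{S}}}\cap\mathcal{G}_{\le3}=\{K_1,\overline{K_2},K_2,P_3,K_3,\overline{K_3},K_2\sqcup K_1\}$.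
   Context: All graphs are finite and simple with nonempty vertex set; $d(v)$ denotes degree. For $T\subseteq V(G)$, an orientation is $T$-odd if every vertex $v$ has odd in-degree iff $v\in T$; acyclic means no directed cycle. $Source(T)=V(G)\setminus T$, $Sink(T)=\{v\in T: d(v)\text{ odd}\}\cup\{v\notin T: d(v)\text{ even}\}$. $(\mathcal{P})$: $|E(G)|+|T|$ even. $(\mathcal{S})$: $Source(T)\neq\emptyset$ and if $|Source(T)|=1$ then $|V(G)|=1$ or $Source(T)\neq Sink(T)$. $(\overline{\mathcal{S}})$: $Sink(T)\neq\emptyset$ and if $|Sink(T)|=1$ then $|V(G)|=1$ or $Sink(T)\neq Source(T)$. For $\mathcal{N}\subseteq\{\mathcal{P},\mathcal{S},\overline{\mathcal{S}}\}$, $\mathcal{C}_{\mathcal{N}}$ is the class of graphs $G$ admitting an acyclic $T$-odd orientation for every $T\subseteq V(G)$ satisfying all conditions in $\mathcal{N}$. -}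

module Defs where

open import Data.Nat using (ℕ; zero; suc; _+_; _%_; _≤_; _/_)
open import Data.Bool using (Bool; true; false; not; _∧_; if_then_else_)
open import Data.Fin using (Fin; zero; suc; _<?_)
import Data.Fin as F
open import Data.List using (List; []; _∷_)
open import Data.List.Relation.Unary.All using (All)
open import Data.Product using (Σ; ∃; _×_; _,_)
open import Data.Sum using (_⊎_)
open import Data.Empty using (⊥)
open import Relation.Nullary using (¬_; ⌊_⌋)
open import Relation.Binary.PropositionalEquality using (_≡_; refl)
open import Relation.Binary.Construct.Closure.Transitive using (TransClosure)
open import Function.Bundles using (_⇔_; _↔_; Inverse)

record Graph : Set where
  field
    n   : ℕ
    adj : Fin n → Fin n → Bool
    adj-sym : ∀ u v → adj u v ≡ adj v u
    adj-irr : ∀ v → adj v v ≡ false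
open Graph public

count : ∀ {m} → (Fin m → Bool) → ℕ
count {zero}  p = 0
count {suc m} p = (if p zero then 1 else 0) + count (λ i → p (suc i))

deg : (G : Graph) → Fin (n G) → ℕ
deg G v = count (λ u → adj G u v)

sumFin : ∀ {m} → (Fin m → ℕ) → ℕ
sumFin {zero}  f = 0
sumFin {suc m} f = f zero + sumFin (λ i → f (suc i))

numEdges : Graph → ℕ
numEdges G = sumFin (λ u → count (λ v → adj G u v ∧ ⌊ u <? v ⌋))

Subset : Graph → Set
Subset G = Fin (n G) → Bool

-- an orientation of G: arc u v = true means the edge uv is oriented u → v
record Orientation (G : Graph) : Set where
  field
    arc : Fin (n G) → Fin (n G) → Bool
    arc-edge : ∀ u v → arc u v ≡ true → adj G u v ≡ true
    arc-orient : ∀ u v → adj G u v ≡ true → arc u v ≡ not (arc v u)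
open Orientation public

indeg : {G : Graph} → Orientation G → Fin (n G) → ℕ
indeg o v = count (λ u → arc o u v)

Odd : ℕ → Set
Odd k = k % 2 ≡ 1

Even : ℕ → Set
Even k = k % 2 ≡ 0

IsTOdd : {G : Graph} → Subset G → Orientation G → Set
IsTOdd T o = ∀ v → Odd (indeg o v) ⇔ (T v ≡ true)

Acyclic : {G : Graph} → Orientation G → Set
Acyclic o = ∀ v → ¬ TransClosure (λ u w → arc o u w ≡ true) v v

Source : (G : Graph) → Subset G → Subset G
Source G T v = not (T v)

Sink : (G : Graph) → Subset G → Subset G
Sink G T v = if T v then (deg G v % 2 Data.Nat.≡ᵇ 1) else (deg G v % 2 Data.Nat.≡ᵇ 0)

SameSubset : {G : Graph} → Subset G → Subset G → Set
SameSubset A B = ∀ v → A v ≡ B v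

Nonempty : {G : Graph} → Subset G → Set
Nonempty A = ∃ λ v → A v ≡ true

CondP : (G : Graph) → Subset G → Set
CondP G T = Even (numEdges G + count T)

CondS : (G : Graph) → Subset G → Set
CondS G T = Nonempty {G} (Source G T) ×
  (count (Source G T) ≡ 1 → n G ≡ 1 ⊎ ¬ SameSubset {G} (Source G T) (Sink G T))

CondS̄ : (G : Graph) → Subset G → Set
CondS̄ G T = Nonempty {G} (Sink G T) ×
  (count (Sink G T) ≡ 1 → n G ≡ 1 ⊎ ¬ SameSubset {G} (Sink G T) (Source G T))

data Cond : Set where
  𝓟 𝓢 𝓢̄ : Cond

Holds : Cond → (G : Graph) → Subset G → Set
Holds 𝓟 = CondP
Holds 𝓢 = CondS
Holds 𝓢̄ = CondS̄

InClass : List Cond → Graph → Set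
InClass N G = (T : Subset G) → All (λ c → Holds c G T) N →
  Σ (Orientation G) λ o → IsTOdd T o × Acyclic o

-- G ∈ 𝓖_{≤3} (graphs have nonempty vertex set)
Le3 : Graph → Set
Le3 G = 1 ≤ n G × n G ≤ 3

_≅_ : Graph → Graph → Set
G ≅ H = Σ (Fin (n G) ↔ Fin (n H)) λ f →
  ∀ u v → adj H (Inverse.to f u) (Inverse.to f v) ≡ adj G u v

emptyAdj : ∀ {m} → Fin m → Fin m → Bool
emptyAdj _ _ = false

K₁ : Graph
K₁ = record { n = 1 ; adj = emptyAdj ; adj-sym = λ _ _ → refl ; adj-irr = λ _ → refl }

K̄₂ : Graph
K̄₂ = record { n = 2 ; adj = emptyAdj ; adj-sym = λ _ _ → refl ; adj-irr = λ _ → refl }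

K̄₃ : Graph
K̄₃ = record { n = 3 ; adj = emptyAdj ; adj-sym = λ _ _ → refl ; adj-irr = λ _ → refl }

compAdj : ∀ {m} → Fin m → Fin m → Bool
compAdj u v = not ⌊ u F.≟ v ⌋

K₂ : Graph
K₂ = record { n = 2 ; adj = compAdj ; adj-sym = s ; adj-irr = i }
  where
  s : ∀ u v → compAdj {2} u v ≡ compAdj v u
  s zero zero = refl
  s zero (suc zero) = refl
  s (suc zero) zero = refl
  s (suc zero) (suc zero) = refl
  i : ∀ v → compAdj {2} v v ≡ false
  i zero = refl
  i (suc zero) = refl

K₃ : Graph
K₃ = record { n = 3 ; adj = compAdj ; adj-sym = s ; adj-irr = i }
  where
  s : ∀ u v → compAdj {3} u v ≡ compAdj v u
  s zero zero = refl
  s zero (suc zero) = refl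
  s zero (suc (suc zero)) = refl
  s (suc zero) zero = refl
  s (suc zero) (suc zero) = refl
  s (suc zero) (suc (suc zero)) = refl
  s (suc (suc zero)) zero = refl
  s (suc (suc zero)) (suc zero) = refl
  s (suc (suc zero)) (suc (suc zero)) = refl
  i : ∀ v → compAdj {3} v v ≡ false
  i zero = refl
  i (suc zero) = refl
  i (suc (suc zero)) = refl

p3Adj : Fin 3 → Fin 3 → Bool
p3Adj zero (suc zero) = true
p3Adj (suc zero) zero = true
p3Adj (suc zero) (suc (suc zero)) = true
p3Adj (suc (suc zero)) (suc zero) = true
p3Adj _ _ = false

P₃ : Graph
P₃ = record { n = 3 ; adj = p3Adj ; adj-sym = s ; adj-irr = i }
  where
  s : ∀ u v → p3Adj u v ≡ p3Adj v u
  s zero zero = refl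
  s zero (suc zero) = refl
  s zero (suc (suc zero)) = refl
  s (suc zero) zero = refl
  s (suc zero) (suc zero) = refl
  s (suc zero) (suc (suc zero)) = refl
  s (suc (suc zero)) zero = refl
  s (suc (suc zero)) (suc zero) = refl
  s (suc (suc zero)) (suc (suc zero)) = refl
  i : ∀ v → p3Adj v v ≡ false
  i zero = refl
  i (suc zero) = refl
  i (suc (suc zero)) = refl

k21Adj : Fin 3 → Fin 3 → Bool
k21Adj zero (suc zero) = true
k21Adj (suc zero) zero = true
k21Adj _ _ = false

K₂⊔K₁ : Graph
K₂⊔K₁ = record { n = 3 ; adj = k21Adj ; adj-sym = s ; adj-irr = i }
  where
  s : ∀ u v → k21Adj u v ≡ k21Adj v u
  s zero zero = refl
  s zero (suc zero) = refl
  s zero (suc (suc zero)) = refl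
  s (suc zero) zero = refl
  s (suc zero) (suc zero) = refl
  s (suc zero) (suc (suc zero)) = refl
  s (suc (suc zero)) zero = refl
  s (suc (suc zero)) (suc zero) = refl
  s (suc (suc zero)) (suc (suc zero)) = refl
  i : ∀ v → k21Adj v v ≡ false
  i zero = refl
  i (suc zero) = refl
  i (suc (suc zero)) = refl

_∈≅_ : Graph → List Graph → Set
G ∈≅ [] = ⊥
G ∈≅ (H ∷ Hs) = G ≅ H ⊎ G ∈≅ Hs

-- Necessity holds in every graph with a vertex. Let o be an acyclic T-odd orientation. Summing
-- in-degrees counts every edge once, so |T| ≡ |E| (mod 2): this is (P). Following arcs forwards
-- or backwards from any vertex ends, by acyclicity and pigeonhole, in a sink or a source. A source
-- has in-degree 0, so it lies in Source(T); a sink has in-degree d(v), so it lies in Sink(T).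
-- If Source(T) = Sink(T) = {s}, then s is the only source and the only sink, and any other vertex
-- would lie on a path from s to s. This gives (S) and (S̄).
-- Sufficiency on at most three vertices: every T satisfying (P), (S) and (S̄) is realized by
-- orienting each edge towards the larger colour of some proper colouring, found by search.
-- Hence G ∈ 𝒞_N iff, for every T, the conditions N imply (P), (S) and (S̄). This, and isomorphism
-- to the listed graphs, is decided by evaluation on the eleven labelled graphs with at most three
-- vertices, and the result is transported to G along pointwise equality of adjacency.
module Submission where

open import Defs
open import Data.Bool using (Bool; true; false; not; _∧_; _∨_; if_then_else_)
import Data.Bool as Bool
open import Data.Bool.Properties using (¬-not; ∨-comm; ∨-identityʳ)
open import Data.Empty using (⊥-elim)
open import Data.Fin using (Fin; zero; suc; _<_; _<?_; toℕ)
import Data.Fin as Fin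
open import Data.Fin.Patterns using (0F; 1F; 2F)
open import Data.Fin.Properties
  using (any?; all?; pigeonhole; toℕ≤pred[n]; <-asym; <-cmp; <-irrefl; <-trans)
open import Data.List using (List; []; _∷_)
open import Data.List.Relation.Unary.All using (All; []; _∷_)
import Data.List.Relation.Unary.All as All
open import Data.Nat using (ℕ; zero; suc; _+_; _*_; _%_; _≡ᵇ_; s≤s)
import Data.Nat as ℕ
open import Data.Nat.DivMod using (m%n<n; %-distribˡ-+)
open import Data.Nat.Properties
  using ( suc-injective; m<1+n⇒m<n∨m≡n; <⇒≤; n<1+n; +-identityʳ; *-identityʳ
        ; *-distribˡ-+; *-distribʳ-+; +-0-commutativeMonoid)
open import Algebra.Properties.CommutativeMonoid.Sum +-0-commutativeMonoid
  using (sum; sum-syntax; sum-cong-≗; ∑-comm; ∑-distrib-+)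
open import Data.Product using (Σ; ∃; _×_; _,_; proj₁; proj₂)
open import Data.Sum using (_⊎_; inj₁; inj₂)
import Data.Sum as Sum
open import Data.Vec.Functional using () renaming (_∷_ to _◂_)
open import Function using (_∘_; case_of_; flip)
open import Function.Bundles using (_⇔_; Equivalence; mk⇔; Inverse; mk↔ₛ′)
open import Function.Properties.Equivalence using () renaming (trans to ⇔-trans)
open import Level using (0ℓ)
open import Relation.Binary using (Rel; Decidable; tri<; tri≈; tri>)
open import Relation.Binary.Construct.Closure.Transitive
  using (TransClosure; [_]; _∷_; _∷ʳ_; _++_)
open import Relation.Binary.PropositionalEquality
  using (_≡_; _≢_; refl; sym; trans; cong; cong₂; subst; subst₂; _≗_; module ≡-Reasoning)
open import Relation.Nullary using (¬_; Dec; yes; no; ⌊_⌋)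
open import Relation.Nullary.Decidable
  using (does; from-yes; map′; ¬?; _⊎-dec_; _×-dec_; _→-dec_; decidable-stable)

open ≡-Reasoning

-- Counting and parity

𝟙 : Bool → ℕ
𝟙 b = if b then 1 else 0

𝟙-∧ : ∀ a b → 𝟙 (a ∧ b) ≡ 𝟙 a * 𝟙 b
𝟙-∧ true  b = sym (+-identityʳ (𝟙 b))
𝟙-∧ false b = refl

𝟙-not : ∀ b → 𝟙 (not b) + 𝟙 b ≡ 1
𝟙-not true  = refl
𝟙-not false = refl

count-cong : ∀ {m} {p q : Fin m → Bool} → p ≗ q → count p ≡ count q
count-cong {zero}  p≗q = refl
count-cong {suc m} p≗q = cong₂ _+_ (cong 𝟙 (p≗q zero)) (count-cong (p≗q ∘ suc))

sumFin-cong : ∀ {m} {f g : Fin m → ℕ} → f ≗ g → sumFin f ≡ sumFin g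
sumFin-cong {zero}  f≗g = refl
sumFin-cong {suc m} f≗g = cong₂ _+_ (f≗g zero) (sumFin-cong (f≗g ∘ suc))

none⇒count≡0 : ∀ {m} {p : Fin m → Bool} → (∀ i → p i ≢ true) → count p ≡ 0
none⇒count≡0 {zero}      none = refl
none⇒count≡0 {suc m} {p} none with p zero in p₀
... | true  = ⊥-elim (none zero p₀)
... | false = none⇒count≡0 (none ∘ suc)

count≡0⇒none : ∀ {m} {p : Fin m → Bool} → count p ≡ 0 → ∀ i → p i ≢ true
count≡0⇒none {suc m} {p} none i pᵢ with p zero in p₀
count≡0⇒none ()   i       pᵢ | true
count≡0⇒none none zero    pᵢ | false = case trans (sym p₀) pᵢ of λ ()
count≡0⇒none none (suc i) pᵢ | false = count≡0⇒none none i pᵢ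

count≡1⇒unique : ∀ {m} {p : Fin m → Bool} → count p ≡ 1 →
                 ∀ {i j} → p i ≡ true → p j ≡ true → i ≡ j
count≡1⇒unique {suc m} {p} one {i} {j} pᵢ pⱼ with p zero in p₀
count≡1⇒unique one {zero}  {zero}  _  _  | true  = refl
count≡1⇒unique one {zero}  {suc j} _  pⱼ | true  = ⊥-elim (count≡0⇒none (suc-injective one) j pⱼ)
count≡1⇒unique one {suc i} {_}     pᵢ _  | true  = ⊥-elim (count≡0⇒none (suc-injective one) i pᵢ)
count≡1⇒unique one {zero}  {_}     pᵢ _  | false = case trans (sym p₀) pᵢ of λ ()
count≡1⇒unique one {suc i} {zero}  _  pⱼ | false = case trans (sym p₀) pⱼ of λ ()
count≡1⇒unique one {suc i} {suc j} pᵢ pⱼ | false = cong suc (count≡1⇒unique one pᵢ pⱼ)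

sumFin≡sum : ∀ {m} (f : Fin m → ℕ) → sumFin f ≡ sum f
sumFin≡sum {zero}  f = refl
sumFin≡sum {suc m} f = cong (f zero +_) (sumFin≡sum (f ∘ suc))

count≡sum : ∀ {m} (p : Fin m → Bool) → count p ≡ sum (𝟙 ∘ p)
count≡sum {zero}  p = refl
count≡sum {suc m} p = cong (𝟙 (p zero) +_) (count≡sum (p ∘ suc))

∑∑-distrib-+ : ∀ {m} (f g : Fin m → Fin m → ℕ) →
               ∑[ u < m ] ∑[ v < m ] (f u v + g u v) ≡
               ∑[ u < m ] ∑[ v < m ] f u v + ∑[ u < m ] ∑[ v < m ] g u v
∑∑-distrib-+ {m} f g = trans (sum-cong-≗ λ u → ∑-distrib-+ (f u) (g u))
                             (∑-distrib-+ (λ u → ∑[ v < m ] f u v) (λ u → ∑[ v < m ] g u v))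

parity : ∀ m → m % 2 ≡ 0 ⊎ m % 2 ≡ 1
parity m with m % 2 | m%n<n m 2
... | 0           | _            = inj₁ refl
... | 1           | _            = inj₂ refl
... | suc (suc _) | s≤s (s≤s ())

same-parity⇒even-sum : ∀ m n → m % 2 ≡ n % 2 → Even (m + n)
same-parity⇒even-sum m n m≡n = begin
  (m + n) % 2          ≡⟨ %-distribˡ-+ m n 2 ⟩
  (m % 2 + n % 2) % 2  ≡⟨ cong (λ k → (m % 2 + k) % 2) (sym m≡n) ⟩
  (m % 2 + m % 2) % 2  ≡⟨ double (parity m) ⟩
  0                    ∎
  where
  double : ∀ {r} → r ≡ 0 ⊎ r ≡ 1 → (r + r) % 2 ≡ 0
  double (inj₁ refl) = refl
  double (inj₂ refl) = refl

count-parity : ∀ {m} {p : Fin m → Bool} (f : Fin m → ℕ) →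
               (∀ i → Odd (f i) ⇔ (p i ≡ true)) → count p % 2 ≡ sumFin f % 2
count-parity {zero}      f _     = refl
count-parity {suc m} {p} f odd⇔p = begin
  (𝟙 (p zero) + count (p ∘ suc)) % 2          ≡⟨ %-distribˡ-+ (𝟙 (p zero)) (count (p ∘ suc)) 2 ⟩
  (𝟙 (p zero) % 2 + count (p ∘ suc) % 2) % 2  ≡⟨ cong₂ (λ a b → (a + b) % 2)
                                                        (bit-parity (f zero) (odd⇔p zero))
                                                        (count-parity (f ∘ suc) (odd⇔p ∘ suc)) ⟩
  (f zero % 2 + sumFin (f ∘ suc) % 2) % 2     ≡⟨ sym (%-distribˡ-+ (f zero) (sumFin (f ∘ suc)) 2) ⟩
  (f zero + sumFin (f ∘ suc)) % 2             ∎
  where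
  bit-parity : ∀ {b} k → Odd k ⇔ (b ≡ true) → 𝟙 b % 2 ≡ k % 2
  bit-parity {true}  k odd⇔b = sym (Equivalence.from odd⇔b refl)
  bit-parity {false} k odd⇔b with parity k
  ... | inj₁ even = sym even
  ... | inj₂ odd  = case Equivalence.to odd⇔b odd of λ ()

all-equal⇒size≡1 : ∀ {m} (s : Fin m) → (∀ w → w ≡ s) → m ≡ 1
all-equal⇒size≡1 {suc zero}    _ _   = refl
all-equal⇒size≡1 {suc (suc m)} s all = case trans (all zero) (sym (all (suc zero))) of λ ()

opposite-orders : ∀ {m} {x y : Fin m} → x ≢ y → ⌊ x <? y ⌋ ≡ not ⌊ y <? x ⌋
opposite-orders {x = x} {y} x≢y with x <? y | y <? x
... | yes x<y | yes y<x = ⊥-elim (<-asym x<y y<x)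
... | yes _   | no _    = refl
... | no _    | yes _   = refl
... | no x≮y  | no y≮x  with <-cmp x y
...   | tri< x<y _   _   = ⊥-elim (x≮y x<y)
...   | tri≈ _   x≡y _   = ⊥-elim (x≢y x≡y)
...   | tri> _   _   y<x = ⊥-elim (y≮x y<x)

exactly-one-order : ∀ {m} {x y : Fin m} → x ≢ y → 𝟙 ⌊ x <? y ⌋ + 𝟙 ⌊ y <? x ⌋ ≡ 1
exactly-one-order {x = x} {y} x≢y =
  trans (cong (λ b → 𝟙 b + 𝟙 ⌊ y <? x ⌋) (opposite-orders x≢y)) (𝟙-not ⌊ y <? x ⌋)

-- Exhaustive search over finite function spaces

Searchable : Set → Set₁
Searchable B = ∀ {P : B → Set} → (∀ b → Dec (P b)) → Dec (∃ P)

any-bool? : Searchable Bool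
any-bool? P? = map′ (λ { (inj₁ p) → true , p ; (inj₂ p) → false , p })
                    (λ { (true , p) → inj₁ p ; (false , p) → inj₂ p })
                    (P? true ⊎-dec P? false)

-- P must respect ≗ because, without function extensionality, an arbitrary f is only
-- pointwise equal to the enumerated function f zero ◂ f ∘ suc.
any-function? : ∀ {B} → Searchable B → ∀ m {P : (Fin m → B) → Set} →
                (∀ {f g} → f ≗ g → P f → P g) → (∀ f → Dec (P f)) → Dec (∃ P)
any-function? search zero resp P? = map′ (empty ,_) (λ (f , p) → resp (λ ()) p) (P? empty)
  where
  empty : Fin 0 → _
  empty ()
any-function? search (suc m) resp P? =
  map′ (λ (b , f , p) → b ◂ f , p)
       (λ (f , p) → f zero , f ∘ suc , resp (λ { zero → refl ; (suc i) → refl }) p)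
       (search λ b → any-function? search m (λ f≗g → resp (λ { zero → refl ; (suc i) → f≗g i }))
                                            (P? ∘ (b ◂_)))

all-function? : ∀ {B} → Searchable B → ∀ m {P : (Fin m → B) → Set} →
                (∀ {f g} → f ≗ g → P f → P g) → (∀ f → Dec (P f)) → Dec (∀ f → P f)
all-function? search m resp P? =
  map′ (λ ∄¬P f → decidable-stable (P? f) (λ ¬Pf → ∄¬P (f , ¬Pf)))
       (λ ∀P (f , ¬Pf) → ¬Pf (∀P f))
       (¬? (any-function? search m (λ f≗g ¬Pf Pg → ¬Pf (resp (sym ∘ f≗g) Pg)) (¬? ∘ P?)))

_⇔-dec_ : ∀ {A B : Set} → Dec A → Dec B → Dec (A ⇔ B)
a? ⇔-dec b? = map′ (λ (f , g) → mk⇔ f g) (λ e → Equivalence.to e , Equivalence.from e)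
                   ((a? →-dec b?) ×-dec (b? →-dec a?))

decided-⇔ : ∀ {A B : Set} (a? : Dec A) (b? : Dec B) → does a? ≡ does b? → A ⇔ B
decided-⇔ (yes a) (yes b) _  = mk⇔ (λ _ → b) (λ _ → a)
decided-⇔ (no ¬a) (no ¬b) _  = mk⇔ (⊥-elim ∘ ¬a) (⊥-elim ∘ ¬b)
decided-⇔ (yes _) (no _)  ()
decided-⇔ (no _)  (yes _) ()

-- Reachability in finite acyclic relations

reverse : ∀ {A : Set} {ℓ} {_∼_ : Rel A ℓ} {x y} → TransClosure (flip _∼_) x y → TransClosure _∼_ y x
reverse [ y∼x ]      = [ y∼x ]
reverse (y∼x ∷ x∼⁺z) = reverse x∼⁺z ∷ʳ y∼x

module _ {n ℓ} {_∼_ : Rel (Fin n) ℓ} (_∼?_ : Decidable _∼_) where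

  private
    _∼⁺_ = TransClosure _∼_

  Walk : ℕ → Fin n → Set ℓ
  Walk k w = Σ (ℕ → Fin n) λ p → p 0 ≡ w × (∀ i → i ℕ.< k → p i ∼ p (suc i))

  walk-segment : ∀ {k w} ((p , _ , _) : Walk k w) {i j} → i ℕ.< j → j ℕ.≤ k → p i ∼⁺ p j
  walk-segment walk@(p , _ , steps) {i} {suc j} i<1+j j<k with m<1+n⇒m<n∨m≡n i<1+j
  ... | inj₁ i<j  = walk-segment walk i<j (<⇒≤ j<k) ∷ʳ steps j j<k
  ... | inj₂ refl = [ steps j j<k ]

  walk-of-length-n⇒cycle : ∀ {w} → Walk n w → ∃ λ v → v ∼⁺ v
  walk-of-length-n⇒cycle walk@(p , _) =
    let i , j , i<j , pᵢ≡pⱼ = pigeonhole (n<1+n n) (p ∘ toℕ)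
    in p (toℕ i) , subst (p (toℕ i) ∼⁺_) (sym pᵢ≡pⱼ) (walk-segment walk i<j (toℕ≤pred[n] j))

  Maximal : Fin n → Set ℓ
  Maximal t = ∀ u → ¬ t ∼ u

  ReachesMaximal : Fin n → Set ℓ
  ReachesMaximal w = ∃ λ t → (w ≡ t ⊎ w ∼⁺ t) × Maximal t

  reaches-maximal-or-walk : ∀ k w → ReachesMaximal w ⊎ Walk k w
  reaches-maximal-or-walk zero    w = inj₂ ((λ _ → w) , refl , λ _ ())
  reaches-maximal-or-walk (suc k) w with any? (w ∼?_)
  ... | no  ∄u = inj₁ (w , inj₁ refl , λ u w∼u → ∄u (u , w∼u))
  ... | yes (u , w∼u) with reaches-maximal-or-walk k u
  ...   | inj₁ (t , inj₁ refl , max) = inj₁ (t , inj₂ [ w∼u ] , max)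
  ...   | inj₁ (t , inj₂ u∼⁺t , max) = inj₁ (t , inj₂ (w∼u ∷ u∼⁺t) , max)
  ...   | inj₂ (p , refl , steps)    =
    inj₂ ((λ { zero → w ; (suc i) → p i }) , refl ,
          λ { zero _ → w∼u ; (suc i) (s≤s i<k) → steps i i<k })

  reaches-maximal : (∀ v → ¬ v ∼⁺ v) → ∀ w → ReachesMaximal w
  reaches-maximal acyclic w with reaches-maximal-or-walk n w
  ... | inj₁ reaches = reaches
  ... | inj₂ walk    = let v , cycle = walk-of-length-n⇒cycle walk in ⊥-elim (acyclic v cycle)

-- Necessity of (P), (S) and (S̄)

module _ {G : Graph} (o : Orientation G) where

  non-edge⇒no-arc : ∀ u v → adj G u v ≡ false → arc o u v ≡ false
  non-edge⇒no-arc u v uv = ¬-not λ e → case trans (sym (arc-edge o u v e)) uv of λ ()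

  no-loop-arc : ∀ v → arc o v v ≡ false
  no-loop-arc v = non-edge⇒no-arc v v (adj-irr G v)

  edge-oriented-once : ∀ u v → 𝟙 (arc o u v) + 𝟙 (arc o v u) ≡ 𝟙 (adj G u v)
  edge-oriented-once u v with adj G u v in uv
  ... | true rewrite arc-orient o u v uv with arc o v u
  ...   | true  = refl
  ...   | false = refl
  edge-oriented-once u v | false
    rewrite non-edge⇒no-arc u v uv | non-edge⇒no-arc v u (trans (adj-sym G v u) uv) = refl

  ascending descending : Fin (n G) → Fin (n G) → ℕ
  ascending  u v = 𝟙 (arc o u v ∧ ⌊ u <? v ⌋)
  descending u v = 𝟙 (arc o v u ∧ ⌊ u <? v ⌋)

  arc-split : ∀ u v → 𝟙 (arc o u v) ≡ ascending u v + descending v u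
  arc-split u v with u Fin.≟ v
  ... | yes refl rewrite no-loop-arc u = refl
  ... | no u≢v = begin
    𝟙 a                                      ≡⟨ sym (*-identityʳ (𝟙 a)) ⟩
    𝟙 a * 1                                  ≡⟨ cong (𝟙 a *_) (sym (exactly-one-order u≢v)) ⟩
    𝟙 a * (𝟙 ⌊ u <? v ⌋ + 𝟙 ⌊ v <? u ⌋)      ≡⟨ *-distribˡ-+ (𝟙 a) (𝟙 ⌊ u <? v ⌋) (𝟙 ⌊ v <? u ⌋) ⟩
    𝟙 a * 𝟙 ⌊ u <? v ⌋ + 𝟙 a * 𝟙 ⌊ v <? u ⌋  ≡⟨ sym (cong₂ _+_ (𝟙-∧ a ⌊ u <? v ⌋) (𝟙-∧ a ⌊ v <? u ⌋)) ⟩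
    𝟙 (a ∧ ⌊ u <? v ⌋) + 𝟙 (a ∧ ⌊ v <? u ⌋)  ∎
    where a = arc o u v

  edge-split : ∀ u v → ascending u v + descending u v ≡ 𝟙 (adj G u v ∧ ⌊ u <? v ⌋)
  edge-split u v = begin
    𝟙 (arc o u v ∧ b) + 𝟙 (arc o v u ∧ b)       ≡⟨ cong₂ _+_ (𝟙-∧ (arc o u v) b) (𝟙-∧ (arc o v u) b) ⟩
    𝟙 (arc o u v) * 𝟙 b + 𝟙 (arc o v u) * 𝟙 b  ≡⟨ sym (*-distribʳ-+ (𝟙 b) (𝟙 (arc o u v)) (𝟙 (arc o v u))) ⟩
    (𝟙 (arc o u v) + 𝟙 (arc o v u)) * 𝟙 b      ≡⟨ cong (_* 𝟙 b) (edge-oriented-once u v) ⟩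
    𝟙 (adj G u v) * 𝟙 b                        ≡⟨ sym (𝟙-∧ (adj G u v) b) ⟩
    𝟙 (adj G u v ∧ b)                          ∎
    where b = ⌊ u <? v ⌋

  sum-indeg≡numEdges : sumFin (indeg o) ≡ numEdges G
  sum-indeg≡numEdges = begin
    sumFin (indeg o)                                 ≡⟨ sumFin≡sum (indeg o) ⟩
    ∑[ v < m ] indeg o v                             ≡⟨ sum-cong-≗ (λ v → count≡sum (λ u → arc o u v)) ⟩
    ∑[ v < m ] ∑[ u < m ] 𝟙 (arc o u v)              ≡⟨ ∑-comm (λ v u → 𝟙 (arc o u v)) ⟩
    ∑[ u < m ] ∑[ v < m ] 𝟙 (arc o u v)              ≡⟨ sum-cong-≗ (λ u → sum-cong-≗ (arc-split u)) ⟩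
    ∑[ u < m ] ∑[ v < m ] (ascending u v + descending v u)
                                                     ≡⟨ ∑∑-distrib-+ ascending (λ u v → descending v u) ⟩
    ∑∑ ascending + ∑[ u < m ] ∑[ v < m ] descending v u
                                                     ≡⟨ cong (∑∑ ascending +_) (∑-comm (λ u v → descending v u)) ⟩
    ∑∑ ascending + ∑∑ descending                     ≡⟨ sym (∑∑-distrib-+ ascending descending) ⟩
    ∑[ u < m ] ∑[ v < m ] (ascending u v + descending u v)
                                                     ≡⟨ sum-cong-≗ (λ u → sum-cong-≗ (edge-split u)) ⟩
    ∑[ u < m ] ∑[ v < m ] 𝟙 (adj G u v ∧ ⌊ u <? v ⌋)  ≡⟨ sym (sum-cong-≗ λ u → count≡sum (λ v → adj G u v ∧ ⌊ u <? v ⌋)) ⟩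
    ∑[ u < m ] count (λ v → adj G u v ∧ ⌊ u <? v ⌋)   ≡⟨ sym (sumFin≡sum λ u → count (λ v → adj G u v ∧ ⌊ u <? v ⌋)) ⟩
    numEdges G                                       ∎
    where
    m = n G
    ∑∑ : (Fin m → Fin m → ℕ) → ℕ
    ∑∑ f = ∑[ u < m ] ∑[ v < m ] f u v

IsSource IsSink : {G : Graph} → Orientation G → Fin (n G) → Set
IsSource o u = ∀ v → arc o v u ≢ true
IsSink   o u = ∀ v → arc o u v ≢ true

sink⇒indeg≡deg : ∀ {G : Graph} (o : Orientation G) {u} → IsSink o u → indeg o u ≡ deg G u
sink⇒indeg≡deg {G} o {u} sink = count-cong λ v → in-arc v (¬-not (sink v))
  where
  in-arc : ∀ v → arc o u v ≡ false → arc o v u ≡ adj G v u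
  in-arc v uv with adj G v u in vu
  ... | true  rewrite arc-orient o v u vu | uv = refl
  ... | false = non-edge⇒no-arc o v u vu

-- (S) is ExtremeCondition G (Source G T) (Sink G T), and (S̄) is ExtremeCondition G (Sink G T) (Source G T).
ExtremeCondition : (G : Graph) → Subset G → Subset G → Set
ExtremeCondition G A B = Nonempty {G} A × (count A ≡ 1 → n G ≡ 1 ⊎ ¬ SameSubset {G} A B)

extremes⇒ExtremeCondition :
  ∀ {G : Graph} {A B : Subset G} {P Q : Fin (n G) → Set} →
  ∃ P → (∀ {u} → P u → A u ≡ true) → (∀ {u} → Q u → B u ≡ true) →
  (∀ s → (∀ u → P u → u ≡ s) → (∀ u → Q u → u ≡ s) → ∀ w → w ≡ s) →
  ExtremeCondition G A B
extremes⇒ExtremeCondition {G} {A} {B} (s , Ps) P⊆A Q⊆B lonely = (s , P⊆A Ps) , single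
  where
  single : count A ≡ 1 → n G ≡ 1 ⊎ ¬ SameSubset {G} A B
  single one with n G ℕ.≟ 1
  ... | yes n≡1 = inj₁ n≡1
  ... | no  n≢1 = inj₂ λ A≗B → n≢1 (all-equal⇒size≡1 s (lonely s
          (λ u Pu → count≡1⇒unique one (P⊆A Pu) (P⊆A Ps))
          (λ u Qu → count≡1⇒unique one (trans (A≗B u) (Q⊆B Qu)) (P⊆A Ps))))

Satisfies : List Cond → (G : Graph) → Subset G → Set
Satisfies N G T = All (λ c → Holds c G T) N

Realizable : (G : Graph) → Subset G → Set
Realizable G T = Σ (Orientation G) λ o → IsTOdd T o × Acyclic o

allConditions : List Cond
allConditions = 𝓟 ∷ 𝓢 ∷ 𝓢̄ ∷ []

module T-odd {G : Graph} {T : Subset G} {o : Orientation G} (todd : IsTOdd T o) where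

  T-odd⇒P : CondP G T
  T-odd⇒P = same-parity⇒even-sum (numEdges G) (count T)
              (trans (cong (_% 2) (sym (sum-indeg≡numEdges o))) (sym (count-parity (indeg o) todd)))

  source∈Source : ∀ {u} → IsSource o u → Source G T u ≡ true
  source∈Source {u} source = cong not (¬-not λ Tu →
    case trans (sym (cong (_% 2) (none⇒count≡0 source))) (Equivalence.from (todd u) Tu) of λ ())

  sink∈Sink : ∀ {u} → IsSink o u → Sink G T u ≡ true
  sink∈Sink {u} sink with T u in Tu | parity (deg G u)
  ... | true  | inj₂ odd  rewrite odd  = refl
  ... | false | inj₁ even rewrite even = refl
  ... | true  | inj₁ even =
    case trans (sym even) (subst Odd (sink⇒indeg≡deg o sink) (Equivalence.from (todd u) Tu)) of λ ()
  ... | false | inj₂ odd  =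
    case trans (sym Tu) (Equivalence.to (todd u) (subst Odd (sym (sink⇒indeg≡deg o sink)) odd)) of λ ()

module AcyclicOrientation {G : Graph} {o : Orientation G} (acyclic : Acyclic o) where

  private
    _⟶_ : Rel (Fin (n G)) 0ℓ
    u ⟶ v = arc o u v ≡ true

  reaches-sink : ∀ w → ∃ λ t → (w ≡ t ⊎ TransClosure _⟶_ w t) × IsSink o t
  reaches-sink = reaches-maximal (λ u v → arc o u v Bool.≟ true) acyclic

  reached-from-source : ∀ w → ∃ λ s → (w ≡ s ⊎ TransClosure _⟶_ s w) × IsSource o s
  reached-from-source w with reaches-maximal (λ u v → arc o v u Bool.≟ true) (λ v → acyclic v ∘ reverse) w
  ... | s , inj₁ w≡s  , source = s , inj₁ w≡s , source
  ... | s , inj₂ s⟶⁺w , source = s , inj₂ (reverse s⟶⁺w) , source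

  sole-source-and-sink : ∀ s → (∀ u → IsSource o u → u ≡ s) → (∀ u → IsSink o u → u ≡ s) → ∀ w → w ≡ s
  sole-source-and-sink s sources sinks w with reaches-sink w | reached-from-source w
  ... | t , inj₁ w≡t , sink   | _                           = trans w≡t (sinks t sink)
  ... | _                     | r , inj₁ w≡r , source       = trans w≡r (sources r source)
  ... | t , inj₂ w⟶⁺t , sink | r , inj₂ r⟶⁺w , source =
    ⊥-elim (acyclic s (subst₂ (TransClosure _⟶_) (sources r source) (sinks t sink) (r⟶⁺w ++ w⟶⁺t)))

realizable⇒allConditions : ∀ {G T} → Fin (n G) → Realizable G T → Satisfies allConditions G T
realizable⇒allConditions {G} {T} v (o , todd , acyclic) =
  T-odd⇒P ∷
  extremes⇒ExtremeCondition {G} source source∈Source sink∈Sink sole-source-and-sink ∷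
  extremes⇒ExtremeCondition {G} sink sink∈Sink source∈Source
    (λ s sinks sources → sole-source-and-sink s sources sinks) ∷ []
  where
  open T-odd {G} {T} {o} todd
  open AcyclicOrientation {G} {o} acyclic
  source = let s , _ , s-source = reached-from-source v in s , s-source
  sink   = let t , _ , t-sink   = reaches-sink v in t , t-sink

-- Sufficiency via proper colourings

Proper : (G : Graph) {k : ℕ} → (Fin (n G) → Fin k) → Set
Proper G c = ∀ u v → adj G u v ≡ true → c u ≢ c v

module Colouring (G : Graph) {k : ℕ} (c : Fin (n G) → Fin k) where

  colour-arc : Fin (n G) → Fin (n G) → Bool
  colour-arc u v = adj G u v ∧ ⌊ c u <? c v ⌋

  orientation : Proper G c → Orientation G
  orientation proper = record
    { arc        = colour-arc
    ; arc-edge   = edge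
    ; arc-orient = orient
    }
    where
    edge : ∀ u v → colour-arc u v ≡ true → adj G u v ≡ true
    edge u v e with adj G u v
    ... | true = refl
    orient : ∀ u v → adj G u v ≡ true → colour-arc u v ≡ not (colour-arc v u)
    orient u v uv rewrite uv | trans (adj-sym G v u) uv = opposite-orders (proper u v uv)

  ascends : ∀ {u v} → colour-arc u v ≡ true → c u < c v
  ascends {u} {v} e with adj G u v | c u <? c v
  ... | true | yes cu<cv = cu<cv

  orientation-acyclic : (proper : Proper G c) → Acyclic (orientation proper)
  orientation-acyclic proper v cycle = <-irrefl refl (climbs cycle)
    where
    climbs : ∀ {u w} → TransClosure (λ x y → colour-arc x y ≡ true) u w → c u < c w
    climbs [ e ]    = ascends e
    climbs (e ∷ es) = <-trans (ascends e) (climbs es)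

TOddColouring : (G : Graph) → Subset G → (Fin (n G) → Fin (n G)) → Set
TOddColouring G T c = Σ (Proper G c) λ proper → IsTOdd T (Colouring.orientation G c proper)

Colourable : Graph → Set
Colourable G = ∀ T → Satisfies allConditions G T → ∃ (TOddColouring G T)

colourable⇒inClass : ∀ {G} → Colourable G → InClass allConditions G
colourable⇒inClass {G} colourable T sat =
  let c , proper , todd = colourable T sat
  in Colouring.orientation G c proper , todd , Colouring.orientation-acyclic G c proper

ImpliesAll : List Cond → Graph → Set
ImpliesAll N G = ∀ T → Satisfies N G T → Satisfies allConditions G T

inClass⇔impliesAll : ∀ {G} → Fin (n G) → InClass allConditions G → ∀ N → InClass N G ⇔ ImpliesAll N G
inClass⇔impliesAll v sufficient N =
  mk⇔ (λ inClass T sat → realizable⇒allConditions v (inClass T sat))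
      (λ impliesAll T sat → sufficient T (impliesAll T sat))

-- Deciding the conditions and isomorphism

ExtremeCondition-resp : ∀ {G : Graph} {A A′ B B′ : Subset G} → A ≗ A′ → B ≗ B′ →
                        ExtremeCondition G A B → ExtremeCondition G A′ B′
ExtremeCondition-resp A≗A′ B≗B′ ((v , Av) , single) =
  (v , trans (sym (A≗A′ v)) Av) ,
  λ one → Sum.map₂ (λ ¬same same′ → ¬same λ u → trans (A≗A′ u) (trans (same′ u) (sym (B≗B′ u))))
                    (single (trans (count-cong A≗A′) one))

Sink-resp : ∀ {G : Graph} {T T′ : Subset G} → T ≗ T′ → Sink G T ≗ Sink G T′
Sink-resp {G} T≗T′ v = cong (λ b → if b then deg G v % 2 ≡ᵇ 1 else deg G v % 2 ≡ᵇ 0) (T≗T′ v)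

holds-resp : ∀ c {G : Graph} {T T′ : Subset G} → T ≗ T′ → Holds c G T → Holds c G T′
holds-resp 𝓟 {G} T≗T′ = subst (λ k → Even (numEdges G + k)) (count-cong T≗T′)
holds-resp 𝓢 {G} T≗T′ = ExtremeCondition-resp {G} (cong not ∘ T≗T′) (Sink-resp {G} T≗T′)
holds-resp 𝓢̄ {G} T≗T′ = ExtremeCondition-resp {G} (Sink-resp {G} T≗T′) (cong not ∘ T≗T′)

satisfies-resp : ∀ N {G : Graph} {T T′ : Subset G} → T ≗ T′ → Satisfies N G T → Satisfies N G T′
satisfies-resp N T≗T′ = All.map (λ {c} → holds-resp c T≗T′)

isTOdd-resp : ∀ {G} {T T′ : Subset G} {o : Orientation G} → T ≗ T′ → IsTOdd T o → IsTOdd T′ o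
isTOdd-resp {o = o} T≗T′ todd v = subst (λ b → Odd (indeg o v) ⇔ (b ≡ true)) (T≗T′ v) (todd v)

tOddColouring-resp : ∀ {G T c c′} → c ≗ c′ → TOddColouring G T c → TOddColouring G T c′
tOddColouring-resp {G} {T} c≗c′ (proper , todd) =
  (λ u v uv cu≡cv → proper u v uv (trans (c≗c′ u) (trans cu≡cv (sym (c≗c′ v))))) ,
  λ v → subst (λ d → Odd d ⇔ (T v ≡ true))
              (count-cong λ u → cong₂ (λ x y → adj G u v ∧ ⌊ x <? y ⌋) (c≗c′ u) (c≗c′ v)) (todd v)

extremeCondition? : ∀ G (A B : Subset G) → Dec (ExtremeCondition G A B)
extremeCondition? G A B = any? (λ v → A v Bool.≟ true) ×-dec
  (count A ℕ.≟ 1 →-dec (n G ℕ.≟ 1 ⊎-dec ¬? (all? λ v → A v Bool.≟ B v)))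

holds? : ∀ c G (T : Subset G) → Dec (Holds c G T)
holds? 𝓟 G T = (numEdges G + count T) % 2 ℕ.≟ 0
holds? 𝓢 G T = extremeCondition? G (Source G T) (Sink G T)
holds? 𝓢̄ G T = extremeCondition? G (Sink G T) (Source G T)

satisfies? : ∀ N G (T : Subset G) → Dec (Satisfies N G T)
satisfies? N G T = All.all? (λ c → holds? c G T) N

impliesAll? : ∀ N G → Dec (ImpliesAll N G)
impliesAll? N G = all-function? any-bool? (n G)
  (λ T≗T′ impliesAll sat′ →
     satisfies-resp allConditions T≗T′ (impliesAll (satisfies-resp N (sym ∘ T≗T′) sat′)))
  (λ T → satisfies? N G T →-dec satisfies? allConditions G T)

isTOdd? : ∀ {G} (T : Subset G) (o : Orientation G) → Dec (IsTOdd T o)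
isTOdd? T o = all? λ v → (indeg o v % 2 ℕ.≟ 1) ⇔-dec (T v Bool.≟ true)

proper? : ∀ G {k} (c : Fin (n G) → Fin k) → Dec (Proper G c)
proper? G c = all? λ u → all? λ v → (adj G u v Bool.≟ true) →-dec ¬? (c u Fin.≟ c v)

tOddColouring? : ∀ G T c → Dec (TOddColouring G T c)
tOddColouring? G T c with proper? G c
... | yes proper = map′ (proper ,_) proj₂ (isTOdd? T (Colouring.orientation G c proper))
... | no ¬proper = no (¬proper ∘ proj₁)

colourable? : ∀ G → Dec (Colourable G)
colourable? G = all-function? any-bool? (n G)
  (λ T≗T′ colourable sat′ →
     let c , proper , todd = colourable (satisfies-resp allConditions (sym ∘ T≗T′) sat′)
     in c , proper , isTOdd-resp {G} {o = Colouring.orientation G c proper} T≗T′ todd)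
  (λ T → satisfies? allConditions G T →-dec
         any-function? any? (n G) (tOddColouring-resp {G} {T}) (tOddColouring? G T))

Preserves : (G H : Graph) → (Fin (n G) → Fin (n H)) → Set
Preserves G H f = ∀ u v → adj H (f u) (f v) ≡ adj G u v

Inverses : ∀ {k l} → (Fin k → Fin l) → (Fin l → Fin k) → Set
Inverses f g = (∀ y → f (g y) ≡ y) × (∀ x → g (f x) ≡ x)

≅? : ∀ G H → Dec (G ≅ H)
≅? G H = map′ (λ (f , pres , g , f∘g , g∘f) → mk↔ₛ′ f g f∘g g∘f , pres)
              (λ (iso , pres) → Inverse.to iso , pres , Inverse.from iso ,
                                Inverse.strictlyInverseˡ iso , Inverse.strictlyInverseʳ iso)
              (any-function? any? (n G) resp-f λ f →
                 preserves? f ×-dec any-function? any? (n H) (resp-g f) (inverses? f))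
  where
  preserves? : ∀ f → Dec (Preserves G H f)
  preserves? f = all? λ u → all? λ v → adj H (f u) (f v) Bool.≟ adj G u v
  inverses? : ∀ f g → Dec (Inverses f g)
  inverses? f g = all? (λ y → f (g y) Fin.≟ y) ×-dec all? (λ x → g (f x) Fin.≟ x)
  resp-g : ∀ f {g g′} → g ≗ g′ → Inverses f g → Inverses f g′
  resp-g f g≗g′ (f∘g , g∘f) = (λ y → trans (cong f (sym (g≗g′ y))) (f∘g y)) ,
                               (λ x → trans (sym (g≗g′ (f x))) (g∘f x))
  resp-f : ∀ {f f′} → f ≗ f′ → Preserves G H f × ∃ (Inverses f) → Preserves G H f′ × ∃ (Inverses f′)
  resp-f f≗f′ (pres , g , f∘g , g∘f) =
    (λ u v → trans (cong₂ (adj H) (sym (f≗f′ u)) (sym (f≗f′ v))) (pres u v)) ,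
    g , (λ y → trans (sym (f≗f′ (g y))) (f∘g y)) , (λ x → trans (cong g (sym (f≗f′ x))) (g∘f x))

∈≅? : ∀ G L → Dec (G ∈≅ L)
∈≅? G []       = no λ ()
∈≅? G (H ∷ Hs) = ≅? G H ⊎-dec ∈≅? G Hs

-- Graphs on at most three vertices

module PointwiseEqualAdjacency
  {m : ℕ} {a b : Fin m → Fin m → Bool}
  {a-sym : ∀ u v → a u v ≡ a v u} {a-irr : ∀ v → a v v ≡ false}
  {b-sym : ∀ u v → b u v ≡ b v u} {b-irr : ∀ v → b v v ≡ false}
  (a≗b : ∀ u v → a u v ≡ b u v) where

  G H : Graph
  G = record { n = m ; adj = a ; adj-sym = a-sym ; adj-irr = a-irr }
  H = record { n = m ; adj = b ; adj-sym = b-sym ; adj-irr = b-irr }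

  sink≗ : ∀ T → Sink G T ≗ Sink H T
  sink≗ T v = cong (λ d → if T v then d % 2 ≡ᵇ 1 else d % 2 ≡ᵇ 0) (count-cong λ u → a≗b u v)

  holds : ∀ c {T} → Holds c G T → Holds c H T
  holds 𝓟 {T} = subst (λ e → Even (e + count T))
                       (sumFin-cong λ u → count-cong λ v → cong (_∧ ⌊ u <? v ⌋) (a≗b u v))
  holds 𝓢 {T} = ExtremeCondition-resp {G} (λ _ → refl) (sink≗ T)
  holds 𝓢̄ {T} = ExtremeCondition-resp {G} (sink≗ T) (λ _ → refl)

  realizable : ∀ {T} → Realizable G T → Realizable H T
  realizable (o , todd , acyclic) = o′ , todd , acyclic
    where
    o′ : Orientation H
    o′ = record
      { arc        = arc o
      ; arc-edge   = λ u v e → trans (sym (a≗b u v)) (arc-edge o u v e)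
      ; arc-orient = λ u v e → arc-orient o u v (trans (a≗b u v) e)
      }

  ∈≅ : ∀ L → G ∈≅ L → H ∈≅ L
  ∈≅ (_ ∷ _)  (inj₁ (f , pres)) = inj₁ (f , λ u v → trans (pres u v) (a≗b u v))
  ∈≅ (_ ∷ Hs) (inj₂ G∈≅Hs)      = inj₂ (∈≅ Hs G∈≅Hs)

classificationTable : List (List Cond × List Graph)
classificationTable =
  (𝓢 ∷ []         , K₁ ∷ K̄₂ ∷ []) ∷
  (𝓢̄ ∷ []         , K₁ ∷ K̄₂ ∷ []) ∷
  (𝓢 ∷ 𝓢̄ ∷ []     , K₁ ∷ K̄₂ ∷ K₂ ∷ []) ∷
  (𝓟 ∷ []         , K₁ ∷ K₂ ∷ P₃ ∷ []) ∷
  (𝓟 ∷ 𝓢 ∷ []     , K₁ ∷ K̄₂ ∷ K₂ ∷ P₃ ∷ K₃ ∷ K̄₃ ∷ []) ∷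
  (𝓟 ∷ 𝓢̄ ∷ []     , K₁ ∷ K̄₂ ∷ K₂ ∷ P₃ ∷ K₃ ∷ K̄₃ ∷ []) ∷
  (𝓟 ∷ 𝓢 ∷ 𝓢̄ ∷ [] , K₁ ∷ K̄₂ ∷ K₂ ∷ P₃ ∷ K₃ ∷ K̄₃ ∷ K₂⊔K₁ ∷ []) ∷ []

Agrees : Graph → List Cond × List Graph → Set
Agrees G (N , L) = InClass N G ⇔ G ∈≅ L

agrees-transport : ∀ {m a b a-sym a-irr b-sym b-irr} (a≗b : ∀ u v → a u v ≡ b u v) →
  All (Agrees (record { n = m ; adj = b ; adj-sym = b-sym ; adj-irr = b-irr })) classificationTable →
  All (Agrees (record { n = m ; adj = a ; adj-sym = a-sym ; adj-irr = a-irr })) classificationTable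
agrees-transport {m} {a} {b} {a-sym} {a-irr} {b-sym} {b-irr} a≗b = All.map λ {(N , L)} H-agrees →
  mk⇔ (λ G-inClass → Back.∈≅ L (Equivalence.to H-agrees λ T sat →
                       There.realizable (G-inClass T (All.map (λ {c} → Back.holds c) sat))))
      (λ G∈≅L T sat → Back.realizable (Equivalence.from H-agrees (There.∈≅ L G∈≅L) T
                                         (All.map (λ {c} → There.holds c) sat)))
  where
  module There = PointwiseEqualAdjacency {m} {a} {b} {a-sym} {a-irr} {b-sym} {b-irr} a≗b
  module Back  = PointwiseEqualAdjacency {m} {b} {a} {b-sym} {b-irr} {a-sym} {a-irr} (λ u v → sym (a≗b u v))

Verified : Graph → Set
Verified G = Colourable G × All (λ (N , L) → does (impliesAll? N G) ≡ does (∈≅? G L)) classificationTable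

verified? : ∀ G → Dec (Verified G)
verified? G = colourable? G ×-dec
  All.all? (λ (N , L) → does (impliesAll? N G) Bool.≟ does (∈≅? G L)) classificationTable

verified⇒agrees : ∀ {G} → Fin (n G) → Verified G → All (Agrees G) classificationTable
verified⇒agrees {G} v (colourable , decisions) = All.map (λ {(N , L)} same →
  ⇔-trans (inClass⇔impliesAll v (colourable⇒inClass colourable) N)
          (decided-⇔ (impliesAll? N G) (∈≅? G L) same))
  decisions

above₃ : Bool → Bool → Bool → Fin 3 → Fin 3 → Bool
above₃ x y z 0F 1F = x
above₃ x y z 0F 2F = y
above₃ x y z 1F 2F = z
above₃ x y z _  _  = false

adj₃ : Bool → Bool → Bool → Fin 3 → Fin 3 → Bool
adj₃ x y z u v = above₃ x y z u v ∨ above₃ x y z v u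

graph₃ : Bool → Bool → Bool → Graph
graph₃ x y z = record
  { n       = 3
  ; adj     = adj₃ x y z
  ; adj-sym = λ u v → ∨-comm (above₃ x y z u v) (above₃ x y z v u)
  ; adj-irr = λ { 0F → refl ; 1F → refl ; 2F → refl }
  }

graph₃-agrees : ∀ x y z → All (Agrees (graph₃ x y z)) classificationTable
graph₃-agrees false false false = verified⇒agrees 0F (from-yes (verified? (graph₃ false false false)))
graph₃-agrees false false true  = verified⇒agrees 0F (from-yes (verified? (graph₃ false false true)))
graph₃-agrees false true  false = verified⇒agrees 0F (from-yes (verified? (graph₃ false true  false)))
graph₃-agrees false true  true  = verified⇒agrees 0F (from-yes (verified? (graph₃ false true  true)))
graph₃-agrees true  false false = verified⇒agrees 0F (from-yes (verified? (graph₃ true  false false)))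
graph₃-agrees true  false true  = verified⇒agrees 0F (from-yes (verified? (graph₃ true  false true)))
graph₃-agrees true  true  false = verified⇒agrees 0F (from-yes (verified? (graph₃ true  true  false)))
graph₃-agrees true  true  true  = verified⇒agrees 0F (from-yes (verified? (graph₃ true  true  true)))

small-graph-agrees : ∀ G → Le3 G → All (Agrees G) classificationTable
small-graph-agrees record { n = 0 } (() , _)
small-graph-agrees record { n = 1 ; adj-irr = irr } _ =
  agrees-transport (λ { 0F 0F → irr 0F }) (verified⇒agrees 0F (from-yes (verified? K₁)))
small-graph-agrees record { n = 2 ; adj = a ; adj-sym = a-sym ; adj-irr = irr } _ with a 0F 1F in a₀₁
... | false = agrees-transport agree (verified⇒agrees 0F (from-yes (verified? K̄₂)))
  where
  agree : ∀ u v → a u v ≡ adj K̄₂ u v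
  agree 0F 0F = irr 0F
  agree 0F 1F = a₀₁
  agree 1F 0F = trans (a-sym 1F 0F) a₀₁
  agree 1F 1F = irr 1F
... | true  = agrees-transport agree (verified⇒agrees 0F (from-yes (verified? K₂)))
  where
  agree : ∀ u v → a u v ≡ adj K₂ u v
  agree 0F 0F = irr 0F
  agree 0F 1F = a₀₁
  agree 1F 0F = trans (a-sym 1F 0F) a₀₁
  agree 1F 1F = irr 1F
small-graph-agrees record { n = 3 ; adj = a ; adj-sym = a-sym ; adj-irr = irr } _ =
  agrees-transport agree (graph₃-agrees (a 0F 1F) (a 0F 2F) (a 1F 2F))
  where
  agree : ∀ u v → a u v ≡ adj₃ (a 0F 1F) (a 0F 2F) (a 1F 2F) u v
  agree 0F 0F = irr 0F
  agree 0F 1F = sym (∨-identityʳ _)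
  agree 0F 2F = sym (∨-identityʳ _)
  agree 1F 0F = a-sym 1F 0F
  agree 1F 1F = irr 1F
  agree 1F 2F = sym (∨-identityʳ _)
  agree 2F 0F = a-sym 2F 0F
  agree 2F 1F = a-sym 2F 1F
  agree 2F 2F = irr 2F
small-graph-agrees record { n = suc (suc (suc (suc _))) } (_ , s≤s (s≤s (s≤s ())))

lemma1 : (G : Graph) → Le3 G →
    (InClass (𝓢 ∷ []) G ⇔ G ∈≅ (K₁ ∷ K̄₂ ∷ [])) ×
    (InClass (𝓢̄ ∷ []) G ⇔ G ∈≅ (K₁ ∷ K̄₂ ∷ [])) ×
    (InClass (𝓢 ∷ 𝓢̄ ∷ []) G ⇔ G ∈≅ (K₁ ∷ K̄₂ ∷ K₂ ∷ [])) ×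
    (InClass (𝓟 ∷ []) G ⇔ G ∈≅ (K₁ ∷ K₂ ∷ P₃ ∷ [])) ×
    (InClass (𝓟 ∷ 𝓢 ∷ []) G ⇔ G ∈≅ (K₁ ∷ K̄₂ ∷ K₂ ∷ P₃ ∷ K₃ ∷ K̄₃ ∷ [])) ×
    (InClass (𝓟 ∷ 𝓢̄ ∷ []) G ⇔ G ∈≅ (K₁ ∷ K̄₂ ∷ K₂ ∷ P₃ ∷ K₃ ∷ K̄₃ ∷ [])) ×
    (InClass (𝓟 ∷ 𝓢 ∷ 𝓢̄ ∷ []) G ⇔ G ∈≅ (K₁ ∷ K̄₂ ∷ K₂ ∷ P₃ ∷ K₃ ∷ K̄₃ ∷ K₂⊔K₁ ∷ []))
lemma1 G le3 with small-graph-agrees G le3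
... | s ∷ s̄ ∷ ss̄ ∷ p ∷ ps ∷ ps̄ ∷ pss̄ ∷ [] = s , s̄ , ss̄ , p , ps , ps̄ , pss̄
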